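{- Let $\mathcal N$ be a Petri net and $m_0$ a marking such that $(\mathcal N,m_0)$ is live and bounded. If $\mathcal N$ has deficiency zero, then $\mathcal N$ is weakly reversible.
   Context: A Petri net is $\mathcal N=(P,T,W^-,W^+)$ with finite disjoint sets $P,T$ and $W^-,W^+\in\mathbb N^{P\times T}$; $W=W^+-W^-$. ${}^\bullet t$ (resp. $t^\bullet$) is the column of $W^-$ (resp. $W^+$) indexed by $t$. A marking is $m\in\mathbb N^P$; $t$ is enabled at $m$ if $m\ge {}^\bullet t$, and firing it yields $m-{}^\bullet t+t^\bullet$. $\mathcal R(m_0)$ is the set of markings reachable from $m_0$ by finite firing sequences. $(\mathcal N,m_0)$ is live if for every $m\in\mathcal R(m_0)$ and every $t\in T$ there is $m'\in\mathcal R(m)$ enabling $t$; it is bounded if $\mathcal R(m_0)$ is finite. Complexes: $\mathcal C=\{{}^\bullet t\}\cup\{t^\bullet\}$; reaction graph: nodes $\mathcal C$, arcs $({}^\bullet t,t^\bullet)$ for $t\in T$. Weakly reversible: every connected component of the reaction graph is strongly connected. Deficiency: $|\mathcal C|-\ell-\mathrm{rank}(W)$ where $\ell$ is the number of connected components of the reaction graph. -}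

module Defs where

open import Data.Nat as ℕ using (ℕ; zero; suc; _≤_; _∸_)
open import Data.Integer as ℤ using (ℤ; +_)
open import Data.Rational as ℚ using (ℚ; 0ℚ)
open import Data.Fin using (Fin; zero; suc)
open import Data.Vec using (Vec; tabulate; lookup)
open import Data.List using (List; length)
open import Data.List.Membership.Propositional using (_∈_)
open import Data.List.Relation.Unary.Unique.Propositional using (Unique)
open import Data.Product using (Σ; ∃; ∃-syntax; _×_; _,_)
open import Data.Sum using (_⊎_)
open import Function.Bundles using (_⇔_)
open import Function.Definitions using (Injective)
open import Relation.Binary.PropositionalEquality using (_≡_)
open import Relation.Binary.Construct.Closure.ReflexiveTransitive using (Star)
open import Relation.Binary.Construct.Closure.Equivalence using (EqClosure)

record PetriNet : Set where
  field
    np  : ℕ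
    nt  : ℕ
    W⁻  : Fin np → Fin nt → ℕ
    W⁺  : Fin np → Fin nt → ℕ

module _ (N : PetriNet) where
  open PetriNet N

  Marking : Set
  Marking = Vec ℕ np

  pre : Fin nt → Vec ℕ np
  pre t = tabulate (λ i → W⁻ i t)

  post : Fin nt → Vec ℕ np
  post t = tabulate (λ i → W⁺ i t)

  Enabled : Fin nt → Marking → Set
  Enabled t m = ∀ i → W⁻ i t ≤ lookup m i

  -- m - •t + t• (the subtraction is exact when t is enabled)
  fire : Fin nt → Marking → Marking
  fire t m = tabulate (λ i → (lookup m i ∸ W⁻ i t) ℕ.+ W⁺ i t)

  Step : Marking → Marking → Set
  Step m m' = ∃[ t ] (Enabled t m × m' ≡ fire t m)

  Reachable : Marking → Marking → Set
  Reachable m m' = Star Step m m'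

  Live : Marking → Set
  Live m₀ = ∀ m → Reachable m₀ m → ∀ t → ∃[ m' ] (Reachable m m' × Enabled t m')

  -- R(m₀) is finite: some finite list contains every reachable marking
  Bounded : Marking → Set
  Bounded m₀ = Σ (List Marking) λ ms → ∀ m → Reachable m₀ m → m ∈ ms

  IsComplex : Vec ℕ np → Set
  IsComplex v = ∃[ t ] (pre t ≡ v ⊎ post t ≡ v)

  Arc : Vec ℕ np → Vec ℕ np → Set
  Arc u v = ∃[ t ] (pre t ≡ u × post t ≡ v)

  Connected : Vec ℕ np → Vec ℕ np → Set
  Connected = EqClosure Arc

  Path : Vec ℕ np → Vec ℕ np → Set
  Path = Star Arc

  NumComplexes : ℕ → Set
  NumComplexes n = Σ (List (Vec ℕ np)) λ cs →
    Unique cs × (∀ v → (v ∈ cs) ⇔ IsComplex v) × length cs ≡ n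

  -- the reaction graph has exactly ℓ connected components:
  -- a labelling of complexes by Fin ℓ, onto, identifying exactly the
  -- connected pairs of complexes
  NumComponents : ℕ → Set
  NumComponents ℓ = Σ (Vec ℕ np → Fin ℓ) λ c →
    (∀ u v → IsComplex u → IsComplex v → (c u ≡ c v) ⇔ Connected u v) ×
    (∀ k → ∃[ v ] (IsComplex v × c v ≡ k))

  Wℚ : Fin np → Fin nt → ℚ
  Wℚ i t = (+ W⁺ i t ℤ.- + W⁻ i t) ℚ./ 1

  ∑ : ∀ {k} → (Fin k → ℚ) → ℚ
  ∑ {zero}  f = 0ℚ
  ∑ {suc k} f = f zero ℚ.+ ∑ (λ j → f (suc j))

  IndependentCols : ∀ {k} → (Fin k → Fin nt) → Set
  IndependentCols {k} f = Injective _≡_ _≡_ f ×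
    (∀ (c : Fin k → ℚ) → (∀ i → ∑ (λ j → c j ℚ.* Wℚ i (f j)) ≡ 0ℚ) →
      ∀ j → c j ≡ 0ℚ)

  Rank : ℕ → Set
  Rank r = (Σ (Fin r → Fin nt) IndependentCols) ×
           (∀ k (f : Fin k → Fin nt) → IndependentCols f → k ≤ r)

  DeficiencyZero : Set
  DeficiencyZero = ∃[ nC ] ∃[ ℓ ] ∃[ r ]
    (NumComplexes nC × NumComponents ℓ × Rank r × nC ≡ ℓ ℕ.+ r)

  WeaklyReversible : Set
  WeaklyReversible = ∀ u v → IsComplex u → IsComplex v → Connected u v → Path u v

module Submission where

-- Liveness lets every transition fire again from every reachable marking, so runs that fire
-- every transition can be chained forever; boundedness makes the chain revisit a marking,
-- which gives a firing cycle σ containing every transition, hence W · #σ = 0 (marking equation).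
-- Embed each complex y as ŷ = (y , e_{component y}) ∈ ℚ^P × ℚ^ℓ. The ℓ embedded component
-- representatives and r independent columns of W (padded by zeros) are ℓ + r independent vectors
-- in the span of the |C| vectors ŷ, so deficiency zero forces the ŷ to be independent. Since
-- Σ_y (#arcs of σ into y − #arcs of σ out of y) · ŷ = W · #σ = 0, every complex is entered and left
-- equally often by σ; in such a balanced multiset of arcs, each arc u → v closes up into a
-- trail from v back to u.

open import Defs

open import Algebra.Bundles using (Ring)
import Algebra.Properties.Group
open import Data.Empty using (⊥-elim)
open import Data.Fin as Fin using (Fin; zero; suc; toℕ; punchIn; _↑ˡ_; _↑ʳ_)
import Data.Fin.Properties as FinP
open import Data.Integer as ℤ using (ℤ; +[1+_]; -[1+_])
import Data.Integer.Properties as ℤP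
open import Data.List as List using (List; []; _∷_; _++_; length; allFin)
open import Data.List.Properties using (length-removeAt′)
open import Data.List.Membership.Propositional using (_∈_)
open import Data.List.Membership.Propositional.Properties using (∈-++⁺ˡ; ∈-++⁺ʳ; ∈-allFin; ∈-lookup)
import Data.List.Relation.Unary.All as All
open import Data.List.Relation.Unary.AllPairs using (_∷_)
open import Data.List.Relation.Unary.Any using (here; there; index; _─_; any?)
open import Data.List.Relation.Unary.Any.Properties using (lookup-index)
open import Data.List.Relation.Unary.Unique.Propositional using (Unique)
open import Data.Nat as Nat using (ℕ; zero; suc; _≤_; _<_; _∸_; z≤n; s≤s)
import Data.Nat.Coprimality as Coprime
import Data.Nat.Properties as ℕP
open import Data.Product using (Σ; ∃; ∃₂; ∃-syntax; _×_; _,_; proj₁; proj₂)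
open import Data.Rational as ℚ using (ℚ; mkℚ; 0ℚ; 1ℚ)
import Data.Rational.Properties as ℚP
open import Data.Rational.Solver using (module +-*-Solver)
open import Data.Sum using (_⊎_; inj₁; inj₂)
open import Data.Vec using (Vec; lookup)
import Data.Vec.Properties as VecP
open import Data.Vec.Functional as Vector using (tail; removeAt; insertAt)
open import Data.Vec.Functional.Properties using (insertAt-lookup; insertAt-punchIn; lookup-++ˡ; lookup-++ʳ)
open import Function using (_∘_)
open import Function.Bundles using (_⇔_; Equivalence)
open import Relation.Binary.Construct.Closure.ReflexiveTransitive using (Star; ε; _◅_; _◅◅_)
open import Relation.Binary.Construct.Closure.Symmetric using (fwd; bwd)
open import Relation.Binary.Definitions using (DecidableEquality)
open import Relation.Binary.PropositionalEquality
open import Relation.Nullary using (Dec; yes; no; ¬_; ¬?)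
open import Relation.Nullary.Decidable using (decidable-stable)

open import Algebra.Properties.Semiring.Sum (Ring.semiring ℚP.+-*-ring)
  using (sum; sum-cong-≗; sum-replicate-zero; sum-remove; ∑-distrib-+; *-distribˡ-sum; *-distribʳ-sum)
module ℚG = Algebra.Properties.Group ℚP.+-0-group
open +-*-Solver

𝟙 : ∀ {P : Set} → Dec P → ℕ
𝟙 (yes _) = 1
𝟙 (no _)  = 0

𝟙-yes : ∀ {P : Set} (d : Dec P) → P → 𝟙 d ≡ 1
𝟙-yes (yes _) _ = refl
𝟙-yes (no ¬p) p = ⊥-elim (¬p p)

𝟙-no : ∀ {P : Set} (d : Dec P) → ¬ P → 𝟙 d ≡ 0
𝟙-no (yes p) ¬p = ⊥-elim (¬p p)
𝟙-no (no _)  _  = refl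

module Multigraph {A X : Set} (_≟_ : DecidableEquality A) (src tgt : X → A) where

  open Nat using (_+_)

  Edge : A → A → Set
  Edge a b = ∃[ x ] (src x ≡ a × tgt x ≡ b)

  count : (X → A) → A → List X → ℕ
  count f a []      = 0
  count f a (x ∷ τ) = 𝟙 (a ≟ f x) + count f a τ

  count-─ : ∀ f a τ {x} (x∈τ : x ∈ τ) → count f a τ ≡ 𝟙 (a ≟ f x) + count f a (τ ─ x∈τ)
  count-─ f a (x ∷ τ)  (here refl) = refl
  count-─ f a (x′ ∷ τ) {x} (there x∈τ) = begin
    𝟙 (a ≟ f x′) + count f a τ                            ≡⟨ cong (𝟙 (a ≟ f x′) +_) (count-─ f a τ x∈τ) ⟩
    𝟙 (a ≟ f x′) + (𝟙 (a ≟ f x) + count f a (τ ─ x∈τ))    ≡⟨ ℕP.+-assoc (𝟙 (a ≟ f x′)) _ _ ⟨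
    𝟙 (a ≟ f x′) + 𝟙 (a ≟ f x) + count f a (τ ─ x∈τ)      ≡⟨ cong (_+ count f a (τ ─ x∈τ)) (ℕP.+-comm (𝟙 (a ≟ f x′)) _) ⟩
    𝟙 (a ≟ f x) + 𝟙 (a ≟ f x′) + count f a (τ ─ x∈τ)      ≡⟨ ℕP.+-assoc (𝟙 (a ≟ f x)) _ _ ⟩
    𝟙 (a ≟ f x) + (𝟙 (a ≟ f x′) + count f a (τ ─ x∈τ))    ∎
    where open ≡-Reasoning

  count-≢0⇒∈ : ∀ f a τ → count f a τ ≢ 0 → ∃[ x ] (x ∈ τ × f x ≡ a)
  count-≢0⇒∈ f a []      c≢0 = ⊥-elim (c≢0 refl)
  count-≢0⇒∈ f a (x ∷ τ) c≢0 with a ≟ f x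
  ... | yes a≡fx = x , here refl , sym a≡fx
  ... | no _     = let x′ , x′∈τ , fx′≡a = count-≢0⇒∈ f a τ c≢0 in x′ , there x′∈τ , fx′≡a

  Balanced : List X → Set
  Balanced σ = ∀ a → count src a σ ≡ count tgt a σ

  -- The degree condition for τ to be the edge multiset of a trail from y to u.
  Eulerian : List X → A → A → Set
  Eulerian τ y u = ∀ a → count src a τ + 𝟙 (a ≟ u) ≡ count tgt a τ + 𝟙 (a ≟ y)

  Eulerian-─ : ∀ {τ x u} (x∈τ : x ∈ τ) → Eulerian τ (src x) u → Eulerian (τ ─ x∈τ) (tgt x) u
  Eulerian-─ {τ} {x} {u} x∈τ eul a = ℕP.+-cancelˡ-≡ s (out′ + 𝟙 (a ≟ u)) (in′ + t) (begin
    s + (out′ + 𝟙 (a ≟ u))     ≡⟨ ℕP.+-assoc s out′ _ ⟨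
    s + out′ + 𝟙 (a ≟ u)       ≡⟨ cong (_+ 𝟙 (a ≟ u)) (count-─ src a τ x∈τ) ⟨
    count src a τ + 𝟙 (a ≟ u)  ≡⟨ eul a ⟩
    count tgt a τ + s          ≡⟨ cong (_+ s) (count-─ tgt a τ x∈τ) ⟩
    t + in′ + s                ≡⟨ ℕP.+-comm (t + in′) s ⟩
    s + (t + in′)              ≡⟨ cong (s +_) (ℕP.+-comm t in′) ⟩
    s + (in′ + t)              ∎)
    where
      open ≡-Reasoning
      s    = 𝟙 (a ≟ src x)
      t    = 𝟙 (a ≟ tgt x)
      out′ = count src a (τ ─ x∈τ)
      in′  = count tgt a (τ ─ x∈τ)

  Eulerian-departure : ∀ {τ y u} → Eulerian τ y u → y ≢ u → count src y τ ≢ 0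
  Eulerian-departure {τ} {y} {u} eul y≢u none = ℕP.0≢1+n (begin
    0                                  ≡⟨ cong₂ _+_ none (𝟙-no (y ≟ u) y≢u) ⟨
    count src y τ + 𝟙 (y ≟ u)          ≡⟨ eul y ⟩
    count tgt y τ + 𝟙 (y ≟ y)          ≡⟨ cong (count tgt y τ +_) (𝟙-yes (y ≟ y) refl) ⟩
    count tgt y τ + 1                  ≡⟨ ℕP.+-comm (count tgt y τ) 1 ⟩
    1 + count tgt y τ                  ∎)
    where open ≡-Reasoning

  Eulerian⇒Path : ∀ τ {y u} → Eulerian τ y u → Star Edge y u
  Eulerian⇒Path τ = walk (length τ) τ refl
    where
      walk : ∀ n τ → length τ ≡ n → ∀ {y u} → Eulerian τ y u → Star Edge y u
      walk n τ len {y} {u} eul with y ≟ u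
      ... | yes refl = ε
      ... | no y≢u with count-≢0⇒∈ src y τ (Eulerian-departure {τ} eul y≢u)
      ...   | x , x∈τ , refl with n | trans (sym len) (length-removeAt′ τ (index x∈τ))
      ...     | suc n′ | refl = (x , refl , refl) ◅ walk n′ (τ ─ x∈τ) refl (Eulerian-─ x∈τ eul)

  Balanced⇒reverse-Path : ∀ {σ x} → Balanced σ → x ∈ σ → Star Edge (tgt x) (src x)
  Balanced⇒reverse-Path {σ} {x} bal x∈σ = Eulerian⇒Path (σ ─ x∈σ) eul
    where
      eul : Eulerian (σ ─ x∈σ) (tgt x) (src x)
      eul a = begin
        count src a (σ ─ x∈σ) + 𝟙 (a ≟ src x)  ≡⟨ ℕP.+-comm _ (𝟙 (a ≟ src x)) ⟩
        𝟙 (a ≟ src x) + count src a (σ ─ x∈σ)  ≡⟨ count-─ src a σ x∈σ ⟨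
        count src a σ                          ≡⟨ bal a ⟩
        count tgt a σ                          ≡⟨ count-─ tgt a σ x∈σ ⟩
        𝟙 (a ≟ tgt x) + count tgt a (σ ─ x∈σ)  ≡⟨ ℕP.+-comm (𝟙 (a ≟ tgt x)) _ ⟩
        count tgt a (σ ─ x∈σ) + 𝟙 (a ≟ tgt x)  ∎
        where open ≡-Reasoning

open import Data.Rational using (_+_; _*_; -_; _-_; 1/_)

ι : ℤ → ℚ
ι i = i ℚ./ 1

ι≡mkℚ : ∀ i → ι i ≡ mkℚ i 0 (Coprime.sym (Coprime.1-coprimeTo ℤ.∣ i ∣))
ι≡mkℚ (ℤ.+ n)  = ℚP.normalize-coprime (Coprime.sym (Coprime.1-coprimeTo n))
ι≡mkℚ -[1+ n ] = cong -_ (ℚP.normalize-coprime (Coprime.sym (Coprime.1-coprimeTo (suc n))))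

ι-+ : ∀ a b → ι (a ℤ.+ b) ≡ ι a + ι b
ι-+ a b = begin
  ι (a ℤ.+ b)                     ≡⟨ cong ι (cong₂ ℤ._+_ (ℤP.*-identityʳ a) (ℤP.*-identityʳ b)) ⟨
  ι (a ℤ.* ℤ.+ 1 ℤ.+ b ℤ.* ℤ.+ 1) ≡⟨ cong₂ _+_ (ι≡mkℚ a) (ι≡mkℚ b) ⟨
  ι a + ι b                       ∎
  where open ≡-Reasoning

ι-+ℕ : ∀ a b → ι (ℤ.+ (a Nat.+ b)) ≡ ι (ℤ.+ a) + ι (ℤ.+ b)
ι-+ℕ a b = trans (cong ι (ℤP.pos-+ a b)) (ι-+ (ℤ.+ a) (ℤ.+ b))

ι-neg : ∀ a → ι (ℤ.- a) ≡ - ι a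
ι-neg (ℤ.+ 0)   = refl
ι-neg +[1+ n ]  = refl
ι-neg -[1+ n ]  = sym (ℚG.⁻¹-involutive (ι +[1+ n ]))

ι-- : ∀ a b → ι (a ℤ.- b) ≡ ι a - ι b
ι-- a b = trans (ι-+ a (ℤ.- b)) (cong (ι a +_) (ι-neg b))

ι-injective : ∀ {a b} → ι a ≡ ι b → a ≡ b
ι-injective {a} {b} ιa≡ιb = cong ℚ.↥_ (trans (sym (ι≡mkℚ a)) (trans ιa≡ιb (ι≡mkℚ b)))

δ : ∀ {P : Set} → Dec P → ℚ
δ d = ι (ℤ.+ 𝟙 d)

δ-yes : ∀ {P : Set} (d : Dec P) → P → δ d ≡ 1ℚ
δ-yes d p = cong (ι ∘ ℤ.+_) (𝟙-yes d p)

δ-no : ∀ {P : Set} (d : Dec P) → ¬ P → δ d ≡ 0ℚ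
δ-no d ¬p = cong (ι ∘ ℤ.+_) (𝟙-no d ¬p)

sum-zero : ∀ {k} {f : Fin k → ℚ} → (∀ j → f j ≡ 0ℚ) → sum f ≡ 0ℚ
sum-zero {k} f≡0 = trans (sum-cong-≗ f≡0) (sum-replicate-zero k)

sum-single : ∀ {k} (p : Fin k) {f : Fin k → ℚ} → (∀ j → j ≢ p → f j ≡ 0ℚ) → sum f ≡ f p
sum-single {suc k} p {f} f≡0 = begin
  sum f                         ≡⟨ sum-remove {i = p} f ⟩
  f p + sum (removeAt f p)      ≡⟨ cong (f p +_) (sum-zero (λ q → f≡0 (punchIn p q) (FinP.punchInᵢ≢i p q))) ⟩
  f p + 0ℚ                      ≡⟨ ℚP.+-identityʳ (f p) ⟩
  f p                           ∎
  where open ≡-Reasoning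

sum-↑ : ∀ m {n} (f : Fin (m Nat.+ n) → ℚ) → sum f ≡ sum (λ j → f (j ↑ˡ n)) + sum (λ j → f (m ↑ʳ j))
sum-↑ zero    f = sym (ℚP.+-identityˡ (sum f))
sum-↑ (suc m) f = trans (cong (f zero +_) (sum-↑ m (tail f))) (sym (ℚP.+-assoc (f zero) _ _))

∑≡sum : ∀ N {k} (f : Fin k → ℚ) → ∑ N f ≡ sum f
∑≡sum N {zero}  f = refl
∑≡sum N {suc k} f = cong (f zero +_) (∑≡sum N (tail f))

module Span (I : Set) where

  V : Set
  V = I → ℚ

  lincomb : ∀ {k} → (Fin k → ℚ) → (Fin k → V) → V
  lincomb c w i = sum (λ j → c j * w j i)

  Independent : ∀ {k} → (Fin k → V) → Set
  Independent v = ∀ c → (∀ i → lincomb c v i ≡ 0ℚ) → ∀ j → c j ≡ 0ℚ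

  InSpan : ∀ {m} → (Fin m → V) → V → Set
  InSpan w u = Σ _ λ b → ∀ i → u i ≡ lincomb b w i

  lincomb-cong : ∀ {k} {b b′ : Fin k → ℚ} → (∀ j → b j ≡ b′ j) → ∀ w i → lincomb b w i ≡ lincomb b′ w i
  lincomb-cong b≡b′ w i = sum-cong-≗ (λ j → cong (_* w j i) (b≡b′ j))

  lincomb-+ : ∀ {k} (b b′ : Fin k → ℚ) w i →
              lincomb (λ j → b j + b′ j) w i ≡ lincomb b w i + lincomb b′ w i
  lincomb-+ b b′ w i = trans (sum-cong-≗ (λ j → ℚP.*-distribʳ-+ (w j i) (b j) (b′ j)))
                             (∑-distrib-+ (λ j → b j * w j i) (λ j → b′ j * w j i))

  lincomb-* : ∀ {k} (s : ℚ) (b : Fin k → ℚ) w i → lincomb (λ j → s * b j) w i ≡ s * lincomb b w i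
  lincomb-* s b w i = trans (sum-cong-≗ (λ j → ℚP.*-assoc s (b j) (w j i)))
                            (sym (*-distribˡ-sum s (λ j → b j * w j i)))

  lincomb-+* : ∀ {k} (b : Fin k → ℚ) (s : ℚ) (b′ : Fin k → ℚ) w i →
               lincomb (λ j → b j + s * b′ j) w i ≡ lincomb b w i + s * lincomb b′ w i
  lincomb-+* b s b′ w i = trans (lincomb-+ b (λ j → s * b′ j) w i)
                                (cong (lincomb b w i +_) (lincomb-* s b′ w i))

  lincomb-unit : ∀ {k} (p : Fin k) w i → lincomb (λ j → δ (j Fin.≟ p)) w i ≡ w p i
  lincomb-unit p w i = begin
    lincomb (λ j → δ (j Fin.≟ p)) w i  ≡⟨ sum-single p off-diagonal ⟩
    δ (p Fin.≟ p) * w p i             ≡⟨ cong (_* w p i) (δ-yes (p Fin.≟ p) refl) ⟩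
    1ℚ * w p i                        ≡⟨ ℚP.*-identityˡ (w p i) ⟩
    w p i                             ∎
    where
      open ≡-Reasoning
      off-diagonal : ∀ j → j ≢ p → δ (j Fin.≟ p) * w j i ≡ 0ℚ
      off-diagonal j j≢p = trans (cong (_* w j i) (δ-no (j Fin.≟ p) j≢p)) (ℚP.*-zeroˡ (w j i))

  lincomb-tail : ∀ {k} (c : Fin (suc k) → ℚ) w i → c zero ≡ 0ℚ →
                 lincomb c w i ≡ lincomb (tail c) (tail w) i
  lincomb-tail c w i c₀≡0 = begin
    c zero * w zero i + rest  ≡⟨ cong (λ x → x * w zero i + rest) c₀≡0 ⟩
    0ℚ * w zero i + rest      ≡⟨ cong (_+ rest) (ℚP.*-zeroˡ (w zero i)) ⟩
    0ℚ + rest                 ≡⟨ ℚP.+-identityˡ rest ⟩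
    rest                      ∎
    where
      open ≡-Reasoning
      rest = lincomb (tail c) (tail w) i

  InSpan-tail : ∀ {m} (w : Fin (suc m) → V) {u} (u-span : InSpan w u) → proj₁ u-span zero ≡ 0ℚ →
                InSpan (tail w) u
  InSpan-tail w (b , u≡) b₀≡0 = tail b , λ i → trans (u≡ i) (lincomb-tail b w i b₀≡0)

  lincomb-− : ∀ {k} (b b′ : Fin k → ℚ) w i →
              lincomb (λ j → b j - b′ j) w i ≡ lincomb b w i - lincomb b′ w i
  lincomb-− b b′ w i = begin
    lincomb (λ j → b j - b′ j) w i               ≡⟨ lincomb-cong (λ j → solve 2 (λ x y → x :- y := x :+ con (- 1ℚ) :* y) refl (b j) (b′ j)) w i ⟩
    lincomb (λ j → b j + - 1ℚ * b′ j) w i        ≡⟨ lincomb-+* b (- 1ℚ) b′ w i ⟩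
    lincomb b w i + - 1ℚ * lincomb b′ w i        ≡⟨ solve 2 (λ x y → x :+ con (- 1ℚ) :* y := x :- y) refl (lincomb b w i) (lincomb b′ w i) ⟩
    lincomb b w i - lincomb b′ w i               ∎
    where open ≡-Reasoning

  lincomb-++ : ∀ {m n} (c : Fin (m Nat.+ n) → ℚ) (u : Fin m → V) (v : Fin n → V) i →
               lincomb c (u Vector.++ v) i ≡ lincomb (λ j → c (j ↑ˡ n)) u i + lincomb (λ a → c (m ↑ʳ a)) v i
  lincomb-++ {m} c u v i = trans (sum-↑ m (λ j → c j * (u Vector.++ v) j i))
    (cong₂ _+_ (sum-cong-≗ (λ j → cong (λ x → c (j ↑ˡ _) * x i) (lookup-++ˡ u v j)))
               (sum-cong-≗ (λ a → cong (λ x → c (m ↑ʳ a) * x i) (lookup-++ʳ u v a))))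

  InSpan-resp : ∀ {m} {w : Fin m → V} {u u′} → (∀ i → u i ≡ u′ i) → InSpan w u → InSpan w u′
  InSpan-resp u≡u′ (b , u≡) = b , λ i → trans (sym (u≡u′ i)) (u≡ i)

  InSpan-member : ∀ {m} (w : Fin m → V) l → InSpan w (w l)
  InSpan-member w l = (λ j → δ (j Fin.≟ l)) , λ i → sym (lincomb-unit l w i)

  InSpan-− : ∀ {m} {w : Fin m → V} {u u′} → InSpan w u → InSpan w u′ → InSpan w (λ i → u i - u′ i)
  InSpan-− {w = w} (b , u≡) (b′ , u′≡) =
    (λ j → b j - b′ j) , λ i → trans (cong₂ _-_ (u≡ i) (u′≡ i)) (sym (lincomb-− b b′ w i))

  InSpan-++ : ∀ {k m n} {w : Fin k → V} {u : Fin m → V} {v : Fin n → V} →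
              (∀ j → InSpan w (u j)) → (∀ a → InSpan w (v a)) → ∀ j → InSpan w ((u Vector.++ v) j)
  InSpan-++ {m = m} u-span v-span j with Fin.splitAt m j
  ... | inj₁ j′ = u-span j′
  ... | inj₂ a  = v-span a

  ++-independent : ∀ {m n} (u : Fin m → V) (v : Fin n → V) (p : Fin m → I) →
                   (∀ j k → u j (p k) ≡ δ (j Fin.≟ k)) → (∀ a k → v a (p k) ≡ 0ℚ) →
                   Independent v → Independent (u Vector.++ v)
  ++-independent {m} {n} u v p u-unit v-zero v-ind c c-rel j =
    subst (λ j → c j ≡ 0ℚ) (FinP.join-splitAt m n j) (by-block (Fin.splitAt m j))
    where
      cᵤ : Fin m → ℚ
      cᵤ k = c (k ↑ˡ n)
      cᵥ : Fin n → ℚ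
      cᵥ a = c (m ↑ʳ a)

      cᵤ≡0 : ∀ k → cᵤ k ≡ 0ℚ
      cᵤ≡0 k = begin
        cᵤ k                                        ≡⟨ ℚP.*-identityʳ (cᵤ k) ⟨
        cᵤ k * 1ℚ                                   ≡⟨ cong (cᵤ k *_) (trans (u-unit k k) (δ-yes (k Fin.≟ k) refl)) ⟨
        cᵤ k * u k (p k)                            ≡⟨ sum-single k off-diagonal ⟨
        lincomb cᵤ u (p k)                          ≡⟨ ℚP.+-identityʳ _ ⟨
        lincomb cᵤ u (p k) + 0ℚ                     ≡⟨ cong (lincomb cᵤ u (p k) +_) (sum-zero (λ a → trans (cong (cᵥ a *_) (v-zero a k)) (ℚP.*-zeroʳ (cᵥ a)))) ⟨
        lincomb cᵤ u (p k) + lincomb cᵥ v (p k)     ≡⟨ lincomb-++ c u v (p k) ⟨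
        lincomb c (u Vector.++ v) (p k)             ≡⟨ c-rel (p k) ⟩
        0ℚ                                          ∎
        where
          open ≡-Reasoning
          off-diagonal : ∀ j → j ≢ k → cᵤ j * u j (p k) ≡ 0ℚ
          off-diagonal j j≢k = trans (cong (cᵤ j *_) (trans (u-unit j k) (δ-no (j Fin.≟ k) j≢k))) (ℚP.*-zeroʳ (cᵤ j))

      cᵥ≡0 : ∀ a → cᵥ a ≡ 0ℚ
      cᵥ≡0 = v-ind cᵥ λ i → begin
        lincomb cᵥ v i                              ≡⟨ ℚP.+-identityˡ _ ⟨
        0ℚ + lincomb cᵥ v i                         ≡⟨ cong (_+ lincomb cᵥ v i) (sum-zero (λ k → trans (cong (_* u k i) (cᵤ≡0 k)) (ℚP.*-zeroˡ (u k i)))) ⟨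
        lincomb cᵤ u i + lincomb cᵥ v i             ≡⟨ lincomb-++ c u v i ⟨
        lincomb c (u Vector.++ v) i                 ≡⟨ c-rel i ⟩
        0ℚ                                          ∎
        where open ≡-Reasoning

      by-block : ∀ s → c (Fin.join m n s) ≡ 0ℚ
      by-block (inj₁ k) = cᵤ≡0 k
      by-block (inj₂ a) = cᵥ≡0 a

  -- Gaussian elimination of the coordinate along w zero, pivoting on v p.
  module Pivot {m k} (w : Fin (suc m) → V) (v : Fin (suc k) → V)
               (b : Fin (suc k) → Fin (suc m) → ℚ) (v≡ : ∀ j i → v j i ≡ lincomb (b j) w i)
               (p : Fin (suc k)) (ap≢0 : b p zero ≢ 0ℚ) where

    instance
      _ : ℚ.NonZero (b p zero)
      _ = ℚ.≢-nonZero ap≢0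

    ratio : Fin k → ℚ
    ratio q = - (b (punchIn p q) zero * 1/ b p zero)

    reduced : Fin k → V
    reduced q i = v (punchIn p q) i + ratio q * v p i

    reduced-InSpan : ∀ q → InSpan (tail w) (reduced q)
    reduced-InSpan q = InSpan-tail w (c , c-spans) c₀≡0
      where
        c : Fin (suc m) → ℚ
        c l = b (punchIn p q) l + ratio q * b p l
        c-spans : ∀ i → reduced q i ≡ lincomb c w i
        c-spans i = trans (cong₂ (λ x y → x + ratio q * y) (v≡ (punchIn p q) i) (v≡ p i))
                          (sym (lincomb-+* (b (punchIn p q)) (ratio q) (b p) w i))
        c₀≡0 : c zero ≡ 0ℚ
        c₀≡0 = begin
          a + - (a * 1/ b p zero) * b p zero  ≡⟨ solve 3 (λ a x y → a :+ (:- (a :* x)) :* y := a :* (con 1ℚ :- x :* y)) refl a (1/ b p zero) (b p zero) ⟩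
          a * (1ℚ - 1/ b p zero * b p zero)  ≡⟨ cong (λ x → a * (1ℚ - x)) (ℚP.*-inverseˡ (b p zero)) ⟩
          a * (1ℚ - 1ℚ)                       ≡⟨ ℚP.*-zeroʳ a ⟩
          0ℚ                                  ∎
          where
            open ≡-Reasoning
            a = b (punchIn p q) zero

    reduced-independent : Independent v → Independent reduced
    reduced-independent v-ind c c-rel q = begin
      c q                ≡⟨ insertAt-punchIn c p cₚ q ⟨
      C (punchIn p q)    ≡⟨ v-ind C C-rel (punchIn p q) ⟩
      0ℚ                 ∎
      where
        open ≡-Reasoning
        cₚ : ℚ
        cₚ = sum (λ q → c q * ratio q)
        C : Fin (suc k) → ℚ
        C = insertAt c p cₚ
        C-rel : ∀ i → lincomb C v i ≡ 0ℚ
        C-rel i = begin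
          lincomb C v i
            ≡⟨ sum-remove {i = p} (λ j → C j * v j i) ⟩
          C p * v p i + sum (λ q → C (punchIn p q) * v (punchIn p q) i)
            ≡⟨ cong₂ _+_ (cong (_* v p i) (insertAt-lookup c p cₚ))
                         (sum-cong-≗ (λ q → cong (_* v (punchIn p q) i) (insertAt-punchIn c p cₚ q))) ⟩
          cₚ * v p i + sum (λ q → c q * v (punchIn p q) i)
            ≡⟨ cong (_+ sum (λ q → c q * v (punchIn p q) i)) (*-distribʳ-sum (v p i) (λ q → c q * ratio q)) ⟩
          sum (λ q → c q * ratio q * v p i) + sum (λ q → c q * v (punchIn p q) i)
            ≡⟨ ∑-distrib-+ (λ q → c q * ratio q * v p i) (λ q → c q * v (punchIn p q) i) ⟨
          sum (λ q → c q * ratio q * v p i + c q * v (punchIn p q) i)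
            ≡⟨ sum-cong-≗ (λ q → solve 4 (λ c r x y → c :* r :* x :+ c :* y := c :* (y :+ r :* x)) refl (c q) (ratio q) (v p i) (v (punchIn p q) i)) ⟩
          lincomb c reduced i
            ≡⟨ c-rel i ⟩
          0ℚ ∎

  independent-InSpan⇒≤ : ∀ m {k} (w : Fin m → V) (v : Fin k → V) →
                         Independent v → (∀ j → InSpan w (v j)) → k ≤ m
  independent-InSpan⇒≤ _       {zero}  w v v-ind v-span = z≤n
  independent-InSpan⇒≤ zero    {suc k} w v v-ind v-span = ⊥-elim (1≢0 (v-ind (λ _ → 1ℚ) all-zero zero))
    where
      1≢0 : 1ℚ ≢ 0ℚ
      1≢0 ()
      all-zero : ∀ i → lincomb (λ _ → 1ℚ) v i ≡ 0ℚ
      all-zero i = sum-zero (λ j → trans (cong (1ℚ *_) (proj₂ (v-span j) i)) (ℚP.*-zeroʳ 1ℚ))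
  independent-InSpan⇒≤ (suc m) {suc k} w v v-ind v-span
    with FinP.any? (λ j → ¬? (proj₁ (v-span j) zero ℚP.≟ 0ℚ))
  ... | yes (p , ap≢0) = s≤s (independent-InSpan⇒≤ m (tail w) reduced
                                 (reduced-independent v-ind) reduced-InSpan)
    where open Pivot w v (λ j → proj₁ (v-span j)) (λ j → proj₂ (v-span j)) p ap≢0
  ... | no no-pivot = ℕP.m≤n⇒m≤1+n (independent-InSpan⇒≤ m (tail w) v v-ind
                        (λ j → InSpan-tail w (v-span j)
                                 (decidable-stable (proj₁ (v-span j) zero ℚP.≟ 0ℚ) (λ a≢0 → no-pivot (j , a≢0)))))

  dependent⇒InSpan-removeAt : ∀ {m} (w : Fin (suc m) → V) (e : Fin (suc m) → ℚ) →
                              (∀ i → lincomb e w i ≡ 0ℚ) → ∀ l → e l ≢ 0ℚ →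
                              InSpan (removeAt w l) (w l)
  dependent⇒InSpan-removeAt w e e-rel l el≢0 = (λ q → s * e (punchIn l q)) , wₗ≡
    where
      instance
        _ : ℚ.NonZero (e l)
        _ = ℚ.≢-nonZero el≢0
      x s : ℚ
      x = 1/ e l
      s = - x
      wₗ≡ : ∀ i → w l i ≡ lincomb (λ q → s * e (punchIn l q)) (removeAt w l) i
      wₗ≡ i = begin
        w l i                                  ≡⟨ solve 2 (λ x wₗ → wₗ := con 1ℚ :* wₗ :- x :* con 0ℚ) refl x (w l i) ⟩
        1ℚ * w l i - x * 0ℚ                    ≡⟨ cong₂ (λ a b → a * w l i - x * b) (ℚP.*-inverseˡ (e l)) e-rel′ ⟨
        x * e l * w l i - x * (e l * w l i + E) ≡⟨ solve 4 (λ x eₗ wₗ E → x :* eₗ :* wₗ :- x :* (eₗ :* wₗ :+ E) := :- x :* E) refl x (e l) (w l i) E ⟩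
        s * E                                  ≡⟨ lincomb-* s (removeAt e l) (removeAt w l) i ⟨
        lincomb (λ q → s * e (punchIn l q)) (removeAt w l) i ∎
        where
          open ≡-Reasoning
          E = lincomb (removeAt e l) (removeAt w l) i
          e-rel′ : e l * w l i + E ≡ 0ℚ
          e-rel′ = trans (sym (sum-remove {i = l} (λ j → e j * w j i))) (e-rel i)

  InSpan-removeAt : ∀ {m} (w : Fin (suc m) → V) l → InSpan (removeAt w l) (w l) →
                    ∀ {u} → InSpan w u → InSpan (removeAt w l) u
  InSpan-removeAt w l (s , wₗ≡) {u} (b , u≡) = (λ q → b (punchIn l q) + b l * s q) , λ i → begin
    u i                                                   ≡⟨ u≡ i ⟩
    lincomb b w i                                         ≡⟨ sum-remove {i = l} (λ j → b j * w j i) ⟩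
    b l * w l i + lincomb (removeAt b l) (removeAt w l) i ≡⟨ cong (λ y → b l * y + _) (wₗ≡ i) ⟩
    b l * lincomb s (removeAt w l) i + lincomb (removeAt b l) (removeAt w l) i
      ≡⟨ ℚP.+-comm (b l * lincomb s (removeAt w l) i) _ ⟩
    lincomb (removeAt b l) (removeAt w l) i + b l * lincomb s (removeAt w l) i
      ≡⟨ lincomb-+* (removeAt b l) (b l) s (removeAt w l) i ⟨
    lincomb (λ q → b (punchIn l q) + b l * s q) (removeAt w l) i ∎
    where open ≡-Reasoning

  InSpan-independent⇒independent : ∀ {m n} (w : Fin m → V) (v : Fin n → V) → m ≤ n →
                                   Independent v → (∀ j → InSpan w (v j)) → Independent w
  InSpan-independent⇒independent {suc m} w v m≤n v-ind v-span e e-rel l with e l ℚP.≟ 0ℚ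
  ... | yes el≡0 = el≡0
  ... | no el≢0  = ⊥-elim (ℕP.1+n≰n (ℕP.≤-trans m≤n (independent-InSpan⇒≤ m (removeAt w l) v v-ind
                     (λ j → InSpan-removeAt w l (dependent⇒InSpan-removeAt w e e-rel l el≢0) (v-span j)))))

pigeonhole-∈ : ∀ {A : Set} (xs : List A) (x : ℕ → A) → (∀ n → x n ∈ xs) →
               ∃₂ λ i j → i < j × x i ≡ x j
pigeonhole-∈ xs x x∈ with FinP.pigeonhole (ℕP.n<1+n (length xs)) (λ k → index (x∈ (toℕ k)))
... | i , j , i<j , same-index = toℕ i , toℕ j , i<j , (begin
  x (toℕ i)                          ≡⟨ lookup-index (x∈ (toℕ i)) ⟩
  List.lookup xs (index (x∈ (toℕ i))) ≡⟨ cong (List.lookup xs) same-index ⟩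
  List.lookup xs (index (x∈ (toℕ j))) ≡⟨ lookup-index (x∈ (toℕ j)) ⟨
  x (toℕ j)                          ∎)
  where open ≡-Reasoning

Unique-lookup-injective : ∀ {A : Set} {xs : List A} → Unique xs →
                          ∀ i j → List.lookup xs i ≡ List.lookup xs j → i ≡ j
Unique-lookup-injective (x∉ ∷ xs-unique) zero    zero    _  = refl
Unique-lookup-injective (x∉ ∷ xs-unique) zero    (suc j) eq = ⊥-elim (All.lookup x∉ (∈-lookup j) eq)
Unique-lookup-injective (x∉ ∷ xs-unique) (suc i) zero    eq = ⊥-elim (All.lookup x∉ (∈-lookup i) (sym eq))
Unique-lookup-injective (x∉ ∷ xs-unique) (suc i) (suc j) eq = cong suc (Unique-lookup-injective xs-unique i j eq)

listSum : ∀ {A : Set} → List A → (A → ℚ) → ℚ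
listSum []      f = 0ℚ
listSum (a ∷ σ) f = f a + listSum σ f

listSum-cong : ∀ {A : Set} (σ : List A) {f f′ : A → ℚ} → (∀ a → f a ≡ f′ a) → listSum σ f ≡ listSum σ f′
listSum-cong []      f≡f′ = refl
listSum-cong (a ∷ σ) f≡f′ = cong₂ _+_ (f≡f′ a) (listSum-cong σ f≡f′)

listSum-zero : ∀ {A : Set} (σ : List A) → listSum σ (λ _ → 0ℚ) ≡ 0ℚ
listSum-zero []      = refl
listSum-zero (a ∷ σ) = cong (0ℚ +_) (listSum-zero σ)

listSum-− : ∀ {A : Set} (σ : List A) (f f′ : A → ℚ) →
            listSum σ (λ a → f a - f′ a) ≡ listSum σ f - listSum σ f′
listSum-− []      f f′ = refl
listSum-− (a ∷ σ) f f′ = trans (cong (f a - f′ a +_) (listSum-− σ f f′))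
  (solve 4 (λ x x′ s s′ → (x :- x′) :+ (s :- s′) := (x :+ s) :- (x′ :+ s′)) refl (f a) (f′ a) (listSum σ f) (listSum σ f′))

module _ (N : PetriNet) where
  open PetriNet N

  infixr 5 _∷_
  data Fires : Marking N → List (Fin nt) → Marking N → Set where
    []  : ∀ {m} → Fires m [] m
    _∷_ : ∀ {m t σ m′} → Enabled N t m → Fires (fire N t m) σ m′ → Fires m (t ∷ σ) m′

  Reachable⇒Fires : ∀ {m m′} → Reachable N m m′ → ∃[ σ ] Fires m σ m′
  Reachable⇒Fires ε                      = [] , []
  Reachable⇒Fires ((t , en , refl) ◅ rs) = let σ , fs = Reachable⇒Fires rs in t ∷ σ , en ∷ fs

  _++ᶠ_ : ∀ {m σ m′ τ m″} → Fires m σ m′ → Fires m′ τ m″ → Fires m (σ ++ τ) m″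
  []        ++ᶠ gs = gs
  (en ∷ fs) ++ᶠ gs = en ∷ (fs ++ᶠ gs)

  tokens : Marking N → Fin np → ℚ
  tokens m i = ι (ℤ.+ lookup m i)

  tokens-fire : ∀ t m → Enabled N t m → ∀ i → tokens (fire N t m) i ≡ tokens m i + Wℚ N i t
  tokens-fire t m en i = begin
    ι (ℤ.+ lookup (fire N t m) i)                ≡⟨ cong (ι ∘ ℤ.+_) (VecP.lookup∘tabulate _ i) ⟩
    ι (ℤ.+ ((lookup m i ∸ W⁻ i t) Nat.+ W⁺ i t)) ≡⟨ cong ι (ℤP.pos-+ (lookup m i ∸ W⁻ i t) (W⁺ i t)) ⟩
    ι (ℤ.+ (lookup m i ∸ W⁻ i t) ℤ.+ x⁺)         ≡⟨ cong (λ d → ι (d ℤ.+ x⁺)) (trans (ℤP.m-n≡m⊖n (lookup m i) (W⁻ i t)) (ℤP.⊖-≥ (en i))) ⟨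
    ι ((x ℤ.- x⁻) ℤ.+ x⁺)                        ≡⟨ cong ι (ℤP.+-assoc x (ℤ.- x⁻) x⁺) ⟩
    ι (x ℤ.+ (ℤ.- x⁻ ℤ.+ x⁺))                    ≡⟨ cong (λ d → ι (x ℤ.+ d)) (ℤP.+-comm (ℤ.- x⁻) x⁺) ⟩
    ι (x ℤ.+ (x⁺ ℤ.- x⁻))                        ≡⟨ ι-+ x (x⁺ ℤ.- x⁻) ⟩
    tokens m i + Wℚ N i t                        ∎
    where
      open ≡-Reasoning
      x  = ℤ.+ lookup m i
      x⁻ = ℤ.+ W⁻ i t
      x⁺ = ℤ.+ W⁺ i t

  marking-equation : ∀ {m σ m′} → Fires m σ m′ → ∀ i → tokens m′ i ≡ tokens m i + listSum σ (Wℚ N i)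
  marking-equation {m} [] i = sym (ℚP.+-identityʳ (tokens m i))
  marking-equation {m} {m′ = m′} (_∷_ {t = t} {σ} en fs) i = begin
    tokens m′ i                                       ≡⟨ marking-equation fs i ⟩
    tokens (fire N t m) i + listSum σ (Wℚ N i)        ≡⟨ cong (_+ listSum σ (Wℚ N i)) (tokens-fire t m en i) ⟩
    tokens m i + Wℚ N i t + listSum σ (Wℚ N i)        ≡⟨ ℚP.+-assoc (tokens m i) (Wℚ N i t) (listSum σ (Wℚ N i)) ⟩
    tokens m i + listSum (t ∷ σ) (Wℚ N i)             ∎
    where open ≡-Reasoning

  cycle⇒kernel : ∀ {m σ} → Fires m σ m → ∀ i → listSum σ (Wℚ N i) ≡ 0ℚ
  cycle⇒kernel {m} fs i = ℚG.identityʳ-unique (tokens m i) _ (sym (marking-equation fs i))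

  CoveringRun : Marking N → Marking N → Set
  CoveringRun m m′ = ∃[ σ ] (Fires m σ m′ × ∀ t → t ∈ σ)

  CoveringRun-trans : ∀ {m m′ m″} → CoveringRun m m′ → CoveringRun m′ m″ → CoveringRun m m″
  CoveringRun-trans (σ , fs , all∈σ) (τ , gs , _) = σ ++ τ , fs ++ᶠ gs , λ t → ∈-++⁺ˡ (all∈σ t)

  module _ {m₀ : Marking N} (live : Live N m₀) where

    fire-each : ∀ ts m → Reachable N m₀ m →
                ∃[ m′ ] (Reachable N m₀ m′ × ∃[ σ ] (Fires m σ m′ × ∀ {t} → t ∈ ts → t ∈ σ))
    fire-each []       m r = m , r , [] , [] , λ ()
    fire-each (t ∷ ts) m r with live m r t
    ... | m₁ , r₁ , en with Reachable⇒Fires r₁ | fire-each ts (fire N t m₁) (r ◅◅ r₁ ◅◅ (t , en , refl) ◅ ε)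
    ... | σ₁ , fs₁ | m′ , r′ , σ , fs , ts⊆σ = m′ , r′ , σ₁ ++ t ∷ σ , fs₁ ++ᶠ (en ∷ fs) , t∷ts⊆
      where
        t∷ts⊆ : ∀ {t′} → t′ ∈ t ∷ ts → t′ ∈ σ₁ ++ t ∷ σ
        t∷ts⊆ (here refl) = ∈-++⁺ʳ σ₁ (here refl)
        t∷ts⊆ (there t′∈) = ∈-++⁺ʳ σ₁ (there (ts⊆σ t′∈))

    covering-step : ∀ m → Reachable N m₀ m → ∃[ m′ ] (Reachable N m₀ m′ × CoveringRun m m′)
    covering-step m r with fire-each (allFin nt) m r
    ... | m′ , r′ , σ , fs , all⊆σ = m′ , r′ , σ , fs , λ t → all⊆σ (∈-allFin t)

    next : ∃ (Reachable N m₀) → ∃ (Reachable N m₀)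
    next (m , r) = let m′ , r′ , _ = covering-step m r in m′ , r′

    next-covering : ∀ x → CoveringRun (proj₁ x) (proj₁ (next x))
    next-covering (m , r) = proj₂ (proj₂ (covering-step m r))

    markings : ℕ → ∃ (Reachable N m₀)
    markings zero    = m₀ , ε
    markings (suc n) = next (markings n)

    covering-run-< : ∀ {i j} → i < j → CoveringRun (proj₁ (markings i)) (proj₁ (markings j))
    covering-run-< {i} {suc j} (s≤s i≤j) with ℕP.m≤n⇒m<n∨m≡n i≤j
    ... | inj₁ i<j  = CoveringRun-trans (covering-run-< i<j) (next-covering (markings j))
    ... | inj₂ refl = next-covering (markings i)

    live∧bounded⇒covering-cycle : Bounded N m₀ → ∃[ m ] CoveringRun m m
    live∧bounded⇒covering-cycle (ms , reachable∈ms)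
      with i , j , i<j , mᵢ≡mⱼ ← pigeonhole-∈ ms (proj₁ ∘ markings) (λ n → reachable∈ms _ (proj₂ (markings n)))
      = proj₁ (markings i) , subst (CoveringRun _) (sym mᵢ≡mⱼ) (covering-run-< i<j)


  _≟ᵥ_ : DecidableEquality (Vec ℕ np)
  _≟ᵥ_ = VecP.≡-dec ℕP._≟_

  open Multigraph _≟ᵥ_ (pre N) (post N) public

  complex-pre : ∀ t → IsComplex N (pre N t)
  complex-pre t = t , inj₁ refl

  complex-post : ∀ t → IsComplex N (post N t)
  complex-post t = t , inj₂ refl

  module ReactionGraph {ℓ r : ℕ} {cs : List (Vec ℕ np)} (cs-unique : Unique cs)
           (cs-complexes : ∀ y → (y ∈ cs) ⇔ IsComplex N y)
           (component : Vec ℕ np → Fin ℓ)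
           (component-connected : ∀ u v → IsComplex N u → IsComplex N v →
                                  (component u ≡ component v) ⇔ Connected N u v)
           (component-onto : ∀ k → ∃[ v ] (IsComplex N v × component v ≡ k))
           (g : Fin r → Fin nt) (g-independent : IndependentCols N g) where

    open Span (Fin np ⊎ Fin ℓ)

    augment : Vec ℕ np → V
    augment y (inj₁ i) = tokens y i
    augment y (inj₂ k) = δ (component y Fin.≟ k)

    augmented-complex : Fin (length cs) → V
    augmented-complex l = augment (List.lookup cs l)

    column : Fin nt → V
    column t (inj₁ i) = Wℚ N i t
    column t (inj₂ k) = 0ℚ

    position : ∀ {y} → IsComplex N y → Fin (length cs)
    position {y} y-complex = index (Equivalence.from (cs-complexes y) y-complex)

    lookup-position : ∀ {y} (y-complex : IsComplex N y) → List.lookup cs (position y-complex) ≡ y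
    lookup-position {y} y-complex = sym (lookup-index (Equivalence.from (cs-complexes y) y-complex))

    same-component : ∀ t → component (pre N t) ≡ component (post N t)
    same-component t = Equivalence.from (component-connected _ _ (complex-pre t) (complex-post t))
                                        (fwd (t , refl , refl) ◅ ε)

    column≡ : ∀ t x → column t x ≡ augment (post N t) x - augment (pre N t) x
    column≡ t (inj₁ i) = trans (ι-- (ℤ.+ W⁺ i t) (ℤ.+ W⁻ i t))
      (sym (cong₂ (λ a b → ι (ℤ.+ a) - ι (ℤ.+ b)) (VecP.lookup∘tabulate _ i) (VecP.lookup∘tabulate _ i)))
    column≡ t (inj₂ k) = trans (sym (ℚP.+-inverseʳ (δ (component (post N t) Fin.≟ k))))
      (cong (λ c → δ (component (post N t) Fin.≟ k) - δ (c Fin.≟ k)) (sym (same-component t)))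

    InSpan-augment : ∀ {y} → IsComplex N y → InSpan augmented-complex (augment y)
    InSpan-augment y-complex = subst (InSpan augmented-complex ∘ augment) (lookup-position y-complex)
                                     (InSpan-member augmented-complex (position y-complex))

    InSpan-column : ∀ t → InSpan augmented-complex (column t)
    InSpan-column t = InSpan-resp (λ x → sym (column≡ t x))
                        (InSpan-− (InSpan-augment (complex-post t)) (InSpan-augment (complex-pre t)))

    generators : Fin (ℓ Nat.+ r) → V
    generators = (augment ∘ proj₁ ∘ component-onto) Vector.++ (column ∘ g)

    generators-independent : Independent generators
    generators-independent = ++-independent _ (column ∘ g) inj₂
      (λ j k → cong (λ c → δ (c Fin.≟ k)) (proj₂ (proj₂ (component-onto j))))
      (λ _ _ → refl)
      (λ c c-rel → proj₂ g-independent c (λ i → trans (∑≡sum N (λ j → c j * Wℚ N i (g j))) (c-rel (inj₁ i))))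

    augmented-complexes-independent : length cs ≤ ℓ Nat.+ r → Independent augmented-complex
    augmented-complexes-independent len≤ = InSpan-independent⇒independent augmented-complex generators len≤
      generators-independent
      (InSpan-++ (λ k → InSpan-augment (proj₁ (proj₂ (component-onto k)))) (InSpan-column ∘ g))

    indicator-position : ∀ {y} (y-complex : IsComplex N y) l →
                         δ (List.lookup cs l ≟ᵥ y) ≡ δ (l Fin.≟ position y-complex)
    indicator-position {y} y-complex l with List.lookup cs l ≟ᵥ y | l Fin.≟ position y-complex
    ... | yes _     | yes _    = refl
    ... | no _      | no _     = refl
    ... | yes csₗ≡y | no l≢p   = ⊥-elim (l≢p (Unique-lookup-injective cs-unique _ _
                                   (trans csₗ≡y (sym (lookup-position y-complex)))))
    ... | no csₗ≢y  | yes refl = ⊥-elim (csₗ≢y (lookup-position y-complex))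

    lincomb-indicator : ∀ {y} → IsComplex N y → ∀ x →
                        lincomb (λ l → δ (List.lookup cs l ≟ᵥ y)) augmented-complex x ≡ augment y x
    lincomb-indicator y-complex x = begin
      lincomb (λ l → δ (List.lookup cs l ≟ᵥ _)) augmented-complex x
        ≡⟨ lincomb-cong (indicator-position y-complex) augmented-complex x ⟩
      lincomb (λ l → δ (l Fin.≟ position y-complex)) augmented-complex x
        ≡⟨ lincomb-unit (position y-complex) augmented-complex x ⟩
      augment (List.lookup cs (position y-complex)) x
        ≡⟨ cong (λ y → augment y x) (lookup-position y-complex) ⟩
      augment _ x ∎
      where open ≡-Reasoning

    multiplicity : (Fin nt → Vec ℕ np) → List (Fin nt) → Fin (length cs) → ℚ
    multiplicity f τ l = ι (ℤ.+ count f (List.lookup cs l) τ)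

    lincomb-multiplicity : ∀ f → (∀ t → IsComplex N (f t)) → ∀ τ x →
                           lincomb (multiplicity f τ) augmented-complex x ≡ listSum τ (λ t → augment (f t) x)
    lincomb-multiplicity f f-complex []      x = sum-zero (λ l → ℚP.*-zeroˡ (augmented-complex l x))
    lincomb-multiplicity f f-complex (t ∷ τ) x = begin
      lincomb (multiplicity f (t ∷ τ)) augmented-complex x
        ≡⟨ lincomb-cong (λ l → ι-+ℕ (𝟙 (List.lookup cs l ≟ᵥ f t)) (count f (List.lookup cs l) τ)) augmented-complex x ⟩
      lincomb (λ l → δ (List.lookup cs l ≟ᵥ f t) + multiplicity f τ l) augmented-complex x
        ≡⟨ lincomb-+ (λ l → δ (List.lookup cs l ≟ᵥ f t)) (multiplicity f τ) augmented-complex x ⟩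
      lincomb (λ l → δ (List.lookup cs l ≟ᵥ f t)) augmented-complex x + lincomb (multiplicity f τ) augmented-complex x
        ≡⟨ cong₂ _+_ (lincomb-indicator (f-complex t) x) (lincomb-multiplicity f f-complex τ x) ⟩
      augment (f t) x + listSum τ (λ t → augment (f t) x) ∎
      where open ≡-Reasoning

    module _ (σ : List (Fin nt)) (σ-kernel : ∀ i → listSum σ (Wℚ N i) ≡ 0ℚ) where

      net-multiplicity : Fin (length cs) → ℚ
      net-multiplicity l = multiplicity (post N) σ l - multiplicity (pre N) σ l

      net-multiplicity-relation : ∀ x → lincomb net-multiplicity augmented-complex x ≡ 0ℚ
      net-multiplicity-relation x = begin
        lincomb net-multiplicity augmented-complex x
          ≡⟨ lincomb-− (multiplicity (post N) σ) (multiplicity (pre N) σ) augmented-complex x ⟩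
        lincomb (multiplicity (post N) σ) augmented-complex x - lincomb (multiplicity (pre N) σ) augmented-complex x
          ≡⟨ cong₂ _-_ (lincomb-multiplicity (post N) complex-post σ x) (lincomb-multiplicity (pre N) complex-pre σ x) ⟩
        listSum σ (λ t → augment (post N t) x) - listSum σ (λ t → augment (pre N t) x)
          ≡⟨ listSum-− σ _ _ ⟨
        listSum σ (λ t → augment (post N t) x - augment (pre N t) x)
          ≡⟨ listSum-cong σ (λ t → column≡ t x) ⟨
        listSum σ (λ t → column t x)
          ≡⟨ column-sum x ⟩
        0ℚ ∎
        where
          open ≡-Reasoning
          column-sum : ∀ x → listSum σ (λ t → column t x) ≡ 0ℚ
          column-sum (inj₁ i) = σ-kernel i
          column-sum (inj₂ k) = listSum-zero σ

      kernel⇒Balanced : length cs ≤ ℓ Nat.+ r → Balanced σ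
      kernel⇒Balanced len≤ z with any? (z ≟ᵥ_) cs
      ... | yes z∈cs = subst (λ z → count (pre N) z σ ≡ count (post N) z σ) (sym (lookup-index z∈cs))
                             (sym (balanced-at (index z∈cs)))
        where
          balanced-at : ∀ l → count (post N) (List.lookup cs l) σ ≡ count (pre N) (List.lookup cs l) σ
          balanced-at l = ℤP.+-injective (ι-injective (ℚG.x∙y⁻¹≈ε⇒x≈y _ _
                            (augmented-complexes-independent len≤ net-multiplicity net-multiplicity-relation l)))
      ... | no z∉cs = trans (count-non-complex (pre N) complex-pre) (sym (count-non-complex (post N) complex-post))
        where
          count-non-complex : ∀ f → (∀ t → IsComplex N (f t)) → count f z σ ≡ 0
          count-non-complex f f-complex = decidable-stable (count f z σ ℕP.≟ 0) λ c≢0 →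
            let t , _ , ft≡z = count-≢0⇒∈ f z σ c≢0
            in z∉cs (Equivalence.from (cs-complexes z) (subst (IsComplex N) ft≡z (f-complex t)))

  DeficiencyZero⇒Balanced : DeficiencyZero N → ∀ σ → (∀ i → listSum σ (Wℚ N i) ≡ 0ℚ) → Balanced σ
  DeficiencyZero⇒Balanced (_ , _ , _ , (_ , cs-unique , cs-complexes , length≡) ,
                           (component , component-connected , component-onto) , ((g , g-independent) , _) , nC≡)
                          σ σ-kernel =
    ReactionGraph.kernel⇒Balanced cs-unique cs-complexes component component-connected component-onto
      g g-independent σ σ-kernel (ℕP.≤-reflexive (trans length≡ nC≡))

  reversible-arcs⇒WeaklyReversible : (∀ t → Path N (post N t) (pre N t)) → WeaklyReversible N
  reversible-arcs⇒WeaklyReversible reverse u v _ _ = Connected⇒Path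
    where
      Connected⇒Path : ∀ {a b} → Connected N a b → Path N a b
      Connected⇒Path ε                            = ε
      Connected⇒Path (fwd arc ◅ c)                = arc ◅ Connected⇒Path c
      Connected⇒Path (bwd (t , refl , refl) ◅ c) = reverse t ◅◅ Connected⇒Path c

proposition3 : (N : PetriNet) (m₀ : Marking N) →
    Live N m₀ → Bounded N m₀ → DeficiencyZero N → WeaklyReversible N
proposition3 N m₀ live bounded deficiency-zero
  with _ , σ , cycle , all∈σ ← live∧bounded⇒covering-cycle N live bounded =
  reversible-arcs⇒WeaklyReversible N λ t → Balanced⇒reverse-Path N balanced (all∈σ t)
  where
    balanced : Balanced N σ
    balanced = DeficiencyZero⇒Balanced N deficiency-zero σ (cycle⇒kernel N cycle)
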